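{- There is a Henkin–Asser structure that, for any $n\ge1$ and $m\ge1$, is a model of \[{}^hax^{(2)}\cup choice_h^{n,m}\cup\{\neg WO^1\}.\]
   Context: Second-order predicate logic with Henkin semantics: for a nonempty set $I$, ${\rm pred}_k(I)$ is the set of maps $I^k\to\{true,false\}$; a predicate structure is $(J_k)_{k\ge0}$ with $J_0=I$ and $\emptyset\ne J_k\subseteq{\rm pred}_k(I)$, $k$-ary predicate quantifiers ranging over $J_k$. A structure is a model of a set of formulas if each is true under every assignment. ${}^hax^{(2)}$ is the set of comprehension axioms $\exists A\forall\mathbf x(A\mathbf x\leftrightarrow G)$ ($G$ any formula in which $A$ is not free, $\mathbf x$ any tuple of distinct individual variables), and a Henkin–Asser structure is a predicate structure that is a model of ${}^hax^{(2)}$. $choice_h^{n,m}$ is the set of all formulas $\forall\mathbf x\exists D\,H(\mathbf x,D)\to\exists S\forall\mathbf x\exists D\big(\forall\mathbf y(D\mathbf y\leftrightarrow S\mathbf x\mathbf y)\land H(\mathbf x,D)\big)$, where $H$ is any second-order formula, $\mathbf x$ an $n$-tuple and $\mathbf y$ an $m$-tuple of distinct individual variables, $D$ an $m$-ary and $S$ an $(n+m)$-ary predicate variable, with $\mathbf y$ and $S$ not occurring in $H$. $WO^1=\forall A\exists T\,wo(T,A)$ with $A$ unary, $T$ binary, where $wo(T,A)$ states: $T$ is a reflexive, antisymmetric, transitive relation on $A$ which is total on $A$ ($\forall x_1\forall x_2(Ax_1\land Ax_2\to Tx_1x_2\lor Tx_2x_1)$), and every $B$ with $\forall x(Bx\to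 Ax)\land\exists xBx$ has an element $x_0$ with $Bx_0\land\forall x_1(Bx_1\to Tx_0x_1)$. -}

module Defs where

open import Data.Nat using (ℕ; zero; suc; _+_; _≡ᵇ_; NonZero)
open import Data.Nat.Properties using (_≟_)
open import Data.Bool using (Bool; true; false; _∧_; _∨_; if_then_else_)
open import Data.Vec using (Vec; []; _∷_; map; lookup; _++_; foldr)
open import Data.Fin using (Fin)
open import Data.Product using (Σ; Σ-syntax; _×_; _,_; proj₁)
open import Data.Sum using (_⊎_)
open import Data.Empty using (⊥)
open import Relation.Nullary using (¬_; yes; no)
open import Relation.Binary.PropositionalEquality using (_≡_; refl)

-- Predicate variables are named by a pair (k , v): the arity index k
-- (the ACTUAL ARITY is suc k, i.e. predicate variables have arity ≥ 1,
-- matching J₀ = I being the individual domain) and a name v.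

data Formula : Set where
  atom  : (k v : ℕ) → Vec ℕ (suc k) → Formula
  ¬'_   : Formula → Formula
  _∧'_  : Formula → Formula → Formula
  _∨'_  : Formula → Formula → Formula
  _⇒'_  : Formula → Formula → Formula
  _⇔'_  : Formula → Formula → Formula
  ∀ᵢ    : ℕ → Formula → Formula
  ∃ᵢ    : ℕ → Formula → Formula
  ∀ₚ    : (k v : ℕ) → Formula → Formula
  ∃ₚ    : (k v : ℕ) → Formula → Formula

infix  9 ¬'_
infixr 8 _∧'_
infixr 7 _∨'_
infixr 6 _⇒'_
infix  5 _⇔'_

∀ᵢ* : ∀ {n} → Vec ℕ n → Formula → Formula
∀ᵢ* []       φ = φ
∀ᵢ* (x ∷ xs) φ = ∀ᵢ x (∀ᵢ* xs φ)

Distinct : ∀ {n} → Vec ℕ n → Set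
Distinct {n} xs = (i j : Fin n) → lookup xs i ≡ lookup xs j → i ≡ j

anyEq : ∀ {n} → ℕ → Vec ℕ n → Bool
anyEq x []       = false
anyEq x (y ∷ ys) = (x ≡ᵇ y) ∨ anyEq x ys

occursᵢ : ℕ → Formula → Bool
occursᵢ x (atom k v ys) = anyEq x ys
occursᵢ x (¬' φ)   = occursᵢ x φ
occursᵢ x (φ ∧' ψ) = occursᵢ x φ ∨ occursᵢ x ψ
occursᵢ x (φ ∨' ψ) = occursᵢ x φ ∨ occursᵢ x ψ
occursᵢ x (φ ⇒' ψ) = occursᵢ x φ ∨ occursᵢ x ψ
occursᵢ x (φ ⇔' ψ) = occursᵢ x φ ∨ occursᵢ x ψ
occursᵢ x (∀ᵢ y φ) = (x ≡ᵇ y) ∨ occursᵢ x φ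
occursᵢ x (∃ᵢ y φ) = (x ≡ᵇ y) ∨ occursᵢ x φ
occursᵢ x (∀ₚ k v φ) = occursᵢ x φ
occursᵢ x (∃ₚ k v φ) = occursᵢ x φ

samePVar : (k v k' v' : ℕ) → Bool
samePVar k v k' v' = (k ≡ᵇ k') ∧ (v ≡ᵇ v')

occursₚ : (k v : ℕ) → Formula → Bool
occursₚ k v (atom k' v' ys) = samePVar k v k' v'
occursₚ k v (¬' φ)   = occursₚ k v φ
occursₚ k v (φ ∧' ψ) = occursₚ k v φ ∨ occursₚ k v ψ
occursₚ k v (φ ∨' ψ) = occursₚ k v φ ∨ occursₚ k v ψ
occursₚ k v (φ ⇒' ψ) = occursₚ k v φ ∨ occursₚ k v ψ
occursₚ k v (φ ⇔' ψ) = occursₚ k v φ ∨ occursₚ k v ψ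
occursₚ k v (∀ᵢ y φ) = occursₚ k v φ
occursₚ k v (∃ᵢ y φ) = occursₚ k v φ
occursₚ k v (∀ₚ k' v' φ) = samePVar k v k' v' ∨ occursₚ k v φ
occursₚ k v (∃ₚ k' v' φ) = samePVar k v k' v' ∨ occursₚ k v φ

freeₚ : (k v : ℕ) → Formula → Bool
freeₚ k v (atom k' v' ys) = samePVar k v k' v'
freeₚ k v (¬' φ)   = freeₚ k v φ
freeₚ k v (φ ∧' ψ) = freeₚ k v φ ∨ freeₚ k v ψ
freeₚ k v (φ ∨' ψ) = freeₚ k v φ ∨ freeₚ k v ψ
freeₚ k v (φ ⇒' ψ) = freeₚ k v φ ∨ freeₚ k v ψ
freeₚ k v (φ ⇔' ψ) = freeₚ k v φ ∨ freeₚ k v ψ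
freeₚ k v (∀ᵢ y φ) = freeₚ k v φ
freeₚ k v (∃ᵢ y φ) = freeₚ k v φ
freeₚ k v (∀ₚ k' v' φ) = if samePVar k v k' v' then false else freeₚ k v φ
freeₚ k v (∃ₚ k' v' φ) = if samePVar k v k' v' then false else freeₚ k v φ

pred : Set → ℕ → Set
pred I k = Vec I (suc k) → Bool

record PredStructure : Set₁ where
  field
    I          : Set
    I-nonempty : I
    J          : (k : ℕ) → pred I k → Set
    J-nonempty : (k : ℕ) → Σ (pred I k) (J k)

module _ (𝔄 : PredStructure) where
  open PredStructure 𝔄

  JElem : ℕ → Set
  JElem k = Σ (pred I k) (J k)

  record Assignment : Set where
    field
      ind : ℕ → I
      prd : (k v : ℕ) → JElem k
  open Assignment

  updᵢ : Assignment → ℕ → I → Assignment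
  ind (updᵢ β x a) y = if x ≡ᵇ y then a else ind β y
  prd (updᵢ β x a)   = prd β

  updPrd : ((k v : ℕ) → JElem k) → (k v : ℕ) → JElem k → (k' v' : ℕ) → JElem k'
  updPrd ρ k v P k' v' with k ≟ k' | v ≟ v'
  ... | yes refl | yes _ = P
  ... | _        | _     = ρ k' v'

  updₚ : Assignment → (k v : ℕ) → JElem k → Assignment
  ind (updₚ β k v P) = ind β
  prd (updₚ β k v P) = updPrd (prd β) k v P

  ⟦_⟧ : Formula → Assignment → Set
  ⟦ atom k v xs ⟧ β = proj₁ (prd β k v) (map (ind β) xs) ≡ true
  ⟦ ¬' φ ⟧   β = ¬ ⟦ φ ⟧ β
  ⟦ φ ∧' ψ ⟧ β = ⟦ φ ⟧ β × ⟦ ψ ⟧ β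
  ⟦ φ ∨' ψ ⟧ β = ⟦ φ ⟧ β ⊎ ⟦ ψ ⟧ β
  ⟦ φ ⇒' ψ ⟧ β = ⟦ φ ⟧ β → ⟦ ψ ⟧ β
  ⟦ φ ⇔' ψ ⟧ β = (⟦ φ ⟧ β → ⟦ ψ ⟧ β) × (⟦ ψ ⟧ β → ⟦ φ ⟧ β)
  ⟦ ∀ᵢ x φ ⟧ β = (a : I) → ⟦ φ ⟧ (updᵢ β x a)
  ⟦ ∃ᵢ x φ ⟧ β = Σ[ a ∈ I ] ⟦ φ ⟧ (updᵢ β x a)
  ⟦ ∀ₚ k v φ ⟧ β = (P : JElem k) → ⟦ φ ⟧ (updₚ β k v P)
  ⟦ ∃ₚ k v φ ⟧ β = Σ[ P ∈ JElem k ] ⟦ φ ⟧ (updₚ β k v P)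

  Valid : Formula → Set
  Valid φ = (β : Assignment) → ⟦ φ ⟧ β

  ModelOf : (Formula → Set) → Set
  ModelOf Φ = (φ : Formula) → Φ φ → Valid φ

hax2 : Formula → Set
hax2 φ = Σ[ k ∈ ℕ ] Σ[ A ∈ ℕ ] Σ[ xs ∈ Vec ℕ (suc k) ] Σ[ G ∈ Formula ]
           Distinct xs × freeₚ k A G ≡ false
         × φ ≡ ∃ₚ k A (∀ᵢ* xs (atom k A xs ⇔' G))

HenkinAsser : PredStructure → Set
HenkinAsser 𝔄 = ModelOf 𝔄 hax2

-- choice_h^{n,m}  (n, m ≥ 1; D has arity m = suc m', S arity n + m)
choiceₕ : (n m : ℕ) → .{{NonZero n}} → .{{NonZero m}} → Formula → Set
choiceₕ (suc n') (suc m') φ =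
  Σ[ H ∈ Formula ] Σ[ xs ∈ Vec ℕ (suc n') ] Σ[ ys ∈ Vec ℕ (suc m') ]
  Σ[ D ∈ ℕ ] Σ[ S ∈ ℕ ]
    Distinct (xs ++ ys)
  × ((x : ℕ) → anyEq x ys ≡ true → occursᵢ x H ≡ false)
  × occursₚ (n' + suc m') S H ≡ false
  × φ ≡ (∀ᵢ* xs (∃ₚ m' D H)
          ⇒' ∃ₚ (n' + suc m') S
               (∀ᵢ* xs (∃ₚ m' D
                  ((∀ᵢ* ys (atom m' D ys ⇔' atom (n' + suc m') S (xs ++ ys)))
                   ∧' H))))

-- WO¹ = ∀A ∃T wo(T,A)
-- Variables: A = (0,0), B = (0,1), X = (0,2) unary; T = (1,0) binary;
-- individuals x = 0, x₁ = 1, x₂ = 2, x₃ = 3, x₀ = 4.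
-- Identity x₁ = x₂ (no identity symbol) is second-order Leibniz identity
-- ∀X (X x₁ ↔ X x₂).

private
  A' B' X' : ℕ → Formula
  A' x = atom 0 0 (x ∷ [])
  B' x = atom 0 1 (x ∷ [])
  X' x = atom 0 2 (x ∷ [])
  T' : ℕ → ℕ → Formula
  T' x y = atom 1 0 (x ∷ y ∷ [])

_≐_ : ℕ → ℕ → Formula
x ≐ y = ∀ₚ 0 2 (X' x ⇔' X' y)

wo : Formula
wo =
    ∀ᵢ 1 (A' 1 ⇒' T' 1 1)
  ∧' ∀ᵢ 1 (∀ᵢ 2 (A' 1 ∧' A' 2 ∧' T' 1 2 ∧' T' 2 1 ⇒' (1 ≐ 2)))
  ∧' ∀ᵢ 1 (∀ᵢ 2 (∀ᵢ 3 (A' 1 ∧' A' 2 ∧' A' 3 ∧' T' 1 2 ∧' T' 2 3 ⇒' T' 1 3)))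
  ∧' ∀ᵢ 1 (∀ᵢ 2 (A' 1 ∧' A' 2 ⇒' T' 1 2 ∨' T' 2 1))
  ∧' ∀ₚ 0 1 (∀ᵢ 0 (B' 0 ⇒' A' 0) ∧' ∃ᵢ 0 (B' 0)
              ⇒' ∃ᵢ 4 (B' 4 ∧' ∀ᵢ 1 (B' 1 ⇒' T' 4 1)))

WO¹ : Formula
WO¹ = ∀ₚ 0 0 (∃ₚ 1 0 wo)

-- 𝔐 has the individuals ℕ and, as k-ary predicates, those with finite support: invariant
-- under every permutation of ℕ that fixes some initial segment [0, N) pointwise.
-- Truth is invariant under permutations, so a formula whose parameters lie below N defines
-- a predicate supported by N; deciding it classically gives comprehension.
-- A binary relation supported by N cannot tell N from N + 1, so a total antisymmetric one
-- would identify them, which the singleton {N} refutes: WO¹ fails.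
-- For choice, a permutation σᵥ fixing the parameters of H carries each tuple v to a
-- canonical tuple below a fixed bound M. Choosing a witness D for each of the finitely many
-- canonical tuples and transporting it back along σᵥ gives S(v, w) = D(σᵥ w), which is
-- supported by M together with the supports of those witnesses.

module Submission where

open import Defs
open import Level using (0ℓ)
open import Data.Nat using (ℕ; NonZero)
open import Data.Product using (Σ; _×_)
open import Relation.Binary.PropositionalEquality using (_≡_)
open import Axiom.ExcludedMiddle using (ExcludedMiddle)

open import Data.Bool using (Bool; true; false; _∨_; _∧_; if_then_else_)
open import Data.Bool.Properties using (∨-zeroʳ; ∧-zeroʳ; T-≡)
open import Data.Nat using (zero; suc; _+_; _*_; _≤_; _<_; _⊔_; _≡ᵇ_; _<?_; _≤?_; s≤s⁻¹)
open import Data.Nat.Properties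
open import Data.Fin using (Fin; zero; suc; toℕ)
import Data.Fin.Properties as Finₚ
open import Data.Fin.Properties using (any?)
open import Data.Vec using (Vec; []; _∷_; _++_; map; lookup; head; splitAt)
open import Data.Vec.Properties using (map-∘; map-cong; map-id; map-++; lookup-map; ++-injective; ++-injectiveʳ)
open import Data.Product using (_,_; proj₁; proj₂; ∃)
open import Data.Sum using (_⊎_; inj₁; inj₂; [_,_])
open import Data.Empty using (⊥)
open import Function using (_∘_; id)
open import Function.Bundles using (_↔_; Inverse; _⇔_; mk⇔; mk↔ₛ′; Equivalence)
open import Function.Properties.Inverse using (↔-refl; ↔-sym; ↔-trans)
open import Function.Properties.Equivalence using () renaming (refl to ⇔-refl; trans to ⇔-trans)
open import Function.Related.TypeIsomorphisms using (→-cong-⇔; ¬-cong-⇔)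
open import Data.Product.Function.NonDependent.Propositional using (_×-⇔_)
open import Data.Sum.Function.Propositional using (_⊎-⇔_)
open import Relation.Nullary using (¬_; Dec; yes; no; does; contradiction; ¬?)
open import Relation.Unary using (Decidable)
open import Relation.Nullary.Decidable using (dec-true; dec-false; does-≡; _×-dec_)
import Relation.Nullary.Decidable as Dec
open import Relation.Binary.PropositionalEquality
  using (_≢_; ≢-sym; refl; sym; trans; cong; cong₂; subst; module ≡-Reasoning)

open Inverse using (to; from; strictlyInverseˡ; strictlyInverseʳ)
open Equivalence using () renaming (to to ⇒; from to ⇐)

-- Finitely supported predicates on ℕ

Fixes : ℕ ↔ ℕ → ℕ → Set
Fixes π N = ∀ i → i < N → to π i ≡ i

SupportedBy : (k : ℕ) → pred ℕ k → ℕ → Set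
SupportedBy k P N = ∀ π → Fixes π N → ∀ w → P (map (to π) w) ≡ P w

Fixes-≤ : ∀ π {M N} → M ≤ N → Fixes π N → Fixes π M
Fixes-≤ π M≤N fix i i<M = fix i (<-≤-trans i<M M≤N)

fixed-preimage : ∀ π {N z} → Fixes π N → to π z < N → to π z ≡ z
fixed-preimage π {z = z} fix πz<N = begin
  to π z                   ≡⟨ strictlyInverseʳ π (to π z) ⟨
  from π (to π (to π z))   ≡⟨ cong (from π) (fix (to π z) πz<N) ⟩
  from π (to π z)          ≡⟨ strictlyInverseʳ π z ⟩
  z                        ∎
  where open ≡-Reasoning

𝔐 : PredStructure
𝔐 = record
  { I          = ℕ
  ; I-nonempty = 0
  ; J          = λ k P → ∃ (SupportedBy k P)
  ; J-nonempty = λ k → (λ _ → false) , 0 , λ _ _ _ → refl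
  }

Elem : ℕ → Set
Elem = JElem 𝔐

ev : ∀ {k} → Elem k → pred ℕ k
ev = proj₁

support : ∀ {k} → Elem k → ℕ
support = proj₁ ∘ proj₂

supported : ∀ {k} (P : Elem k) → SupportedBy k (ev P) (support P)
supported = proj₂ ∘ proj₂

Asg : Set
Asg = Assignment 𝔐

open Assignment

_⊨_ : Asg → Formula → Set
β ⊨ φ = ⟦_⟧ 𝔐 φ β

to-injective : ∀ (π : ℕ ↔ ℕ) {x y} → to π x ≡ to π y → x ≡ y
to-injective π {x} {y} e =
  trans (sym (strictlyInverseʳ π x)) (trans (cong (from π) e) (strictlyInverseʳ π y))

map-to-from : ∀ {n} (π : ℕ ↔ ℕ) (w : Vec ℕ n) → map (to π) (map (from π) w) ≡ w
map-to-from π []      = refl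
map-to-from π (x ∷ w) = cong₂ _∷_ (strictlyInverseˡ π x) (map-to-from π w)

map-from-to : ∀ {n} (π : ℕ ↔ ℕ) (w : Vec ℕ n) → map (from π) (map (to π) w) ≡ w
map-from-to π = map-to-from (↔-sym π)

supBelow : (ℕ → ℕ) → ℕ → ℕ
supBelow g zero    = zero
supBelow g (suc N) = g N ⊔ supBelow g N

supBelow-≥ : ∀ g {N i} → i < N → g i ≤ supBelow g N
supBelow-≥ g {suc N} {i} i<1+N with m≤n⇒m<n∨m≡n (s≤s⁻¹ i<1+N)
... | inj₁ i<N  = ≤-trans (supBelow-≥ g i<N) (m≤n⊔m (g N) _)
... | inj₂ refl = m≤m⊔n (g i) _

supBelowVec : ∀ {n} → ℕ → (Vec ℕ n → ℕ) → ℕ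
supBelowVec {zero}  R g = g []
supBelowVec {suc n} R g = supBelow (λ a → supBelowVec R (g ∘ (a ∷_))) R

supBelowVec-≥ : ∀ {n} R (g : Vec ℕ n → ℕ) c → (∀ i → lookup c i < R) → g c ≤ supBelowVec R g
supBelowVec-≥ R g []      _   = ≤-refl
supBelowVec-≥ R g (a ∷ c) c<R =
  ≤-trans (supBelowVec-≥ R (g ∘ (a ∷_)) c (c<R ∘ suc))
          (supBelow-≥ (λ a → supBelowVec R (g ∘ (a ∷_))) (c<R zero))

push : ∀ {k} → ℕ ↔ ℕ → Elem k → Elem k
push {k} π (P , N , P-supp) = (P ∘ map (from π)) , N′ , supp
  where
  N′ : ℕ
  N′ = supBelow (suc ∘ to π) N
  supp : SupportedBy k (P ∘ map (from π)) N′
  supp ρ ρ-fix w = begin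
      P (map (from π) (map (to ρ) w))  ≡⟨ cong P (map-conjugate w) ⟩
      P (map (to τ) (map (from π) w))  ≡⟨ P-supp τ τ-fix (map (from π) w) ⟩
      P (map (from π) w)               ∎
    where
    open ≡-Reasoning
    -- ρ fixes the image of [0, N) under π, so its conjugate π⁻¹ ρ π fixes [0, N).
    τ : ℕ ↔ ℕ
    τ = ↔-trans (↔-trans π ρ) (↔-sym π)
    τ-fix : Fixes τ N
    τ-fix i i<N = trans (cong (from π) (ρ-fix (to π i) (supBelow-≥ (suc ∘ to π) i<N)))
                        (strictlyInverseʳ π i)
    map-conjugate : ∀ {n} (w : Vec ℕ n) → map (from π) (map (to ρ) w) ≡ map (to τ) (map (from π) w)
    map-conjugate []      = refl
    map-conjugate (x ∷ w) =
      cong₂ _∷_ (cong (from π ∘ to ρ) (sym (strictlyInverseˡ π x))) (map-conjugate w)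

pull : ∀ {k} → ℕ ↔ ℕ → Elem k → Elem k
pull π = push (↔-sym π)

freeᵢ : ℕ → Formula → Bool
freeᵢ x (atom k v ys) = anyEq x ys
freeᵢ x (¬' φ)        = freeᵢ x φ
freeᵢ x (φ ∧' ψ)      = freeᵢ x φ ∨ freeᵢ x ψ
freeᵢ x (φ ∨' ψ)      = freeᵢ x φ ∨ freeᵢ x ψ
freeᵢ x (φ ⇒' ψ)      = freeᵢ x φ ∨ freeᵢ x ψ
freeᵢ x (φ ⇔' ψ)      = freeᵢ x φ ∨ freeᵢ x ψ
freeᵢ x (∀ᵢ y φ)      = if y ≡ᵇ x then false else freeᵢ x φ
freeᵢ x (∃ᵢ y φ)      = if y ≡ᵇ x then false else freeᵢ x φ
freeᵢ x (∀ₚ k v φ)    = freeᵢ x φ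
freeᵢ x (∃ₚ k v φ)    = freeᵢ x φ

≡ᵇ-refl : ∀ n → (n ≡ᵇ n) ≡ true
≡ᵇ-refl n = dec-true (n ≟ n) refl

≡ᵇ-≡ : ∀ m n → (m ≡ᵇ n) ≡ true → m ≡ n
≡ᵇ-≡ m n = ≡ᵇ⇒≡ m n ∘ ⇐ T-≡

∨-≡true⁻ : ∀ a {b} → a ∨ b ≡ true → a ≡ true ⊎ b ≡ true
∨-≡true⁻ true  _ = inj₁ refl
∨-≡true⁻ false e = inj₂ e

∨-≡trueˡ : ∀ {a} b → a ≡ true → a ∨ b ≡ true
∨-≡trueˡ b refl = refl

∨-≡trueʳ : ∀ a {b} → b ≡ true → a ∨ b ≡ true
∨-≡trueʳ a refl = ∨-zeroʳ a

∧-≡true⁻ : ∀ a {b} → a ∧ b ≡ true → a ≡ true × b ≡ true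
∧-≡true⁻ true e = refl , e

ifFalse-≡true⁻ : ∀ b {c} → (if b then false else c) ≡ true → c ≡ true
ifFalse-≡true⁻ false e = e

ifFalse-≡true : ∀ {b c} → b ≡ false → c ≡ true → (if b then false else c) ≡ true
ifFalse-≡true refl e = e

samePVar-refl : ∀ k u → samePVar k u k u ≡ true
samePVar-refl k u = cong₂ _∧_ (≡ᵇ-refl k) (≡ᵇ-refl u)

samePVar-≡ : ∀ k u k′ u′ → samePVar k u k′ u′ ≡ true → k ≡ k′ × u ≡ u′
samePVar-≡ k u k′ u′ e =
  let (k≡k′ , u≡u′) = ∧-≡true⁻ (k ≡ᵇ k′) e in ≡ᵇ-≡ k k′ k≡k′ , ≡ᵇ-≡ u u′ u≡u′

samePVar-≢ : ∀ k u k′ u′ → ¬ (k ≡ k′ × u ≡ u′) → samePVar k u k′ u′ ≡ false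
samePVar-≢ k u k′ u′ ne with k ≟ k′ | u ≟ u′
... | yes k≡k′ | yes u≡u′ = contradiction (k≡k′ , u≡u′) ne
... | no k≢k′  | _        = cong (_∧ (u ≡ᵇ u′)) (dec-false (k ≟ k′) k≢k′)
... | yes _    | no u≢u′  = trans (cong ((k ≡ᵇ k′) ∧_) (dec-false (u ≟ u′) u≢u′)) (∧-zeroʳ _)

freeₚ⇒occursₚ : ∀ k u φ → freeₚ k u φ ≡ true → occursₚ k u φ ≡ true
freeₚ⇒occursₚ-∨ : ∀ k u φ ψ → freeₚ k u φ ∨ freeₚ k u ψ ≡ true →
                  occursₚ k u φ ∨ occursₚ k u ψ ≡ true
freeₚ⇒occursₚ k u (atom _ _ _) e = e
freeₚ⇒occursₚ k u (¬' φ)   e = freeₚ⇒occursₚ k u φ e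
freeₚ⇒occursₚ k u (φ ∧' ψ) e = freeₚ⇒occursₚ-∨ k u φ ψ e
freeₚ⇒occursₚ k u (φ ∨' ψ) e = freeₚ⇒occursₚ-∨ k u φ ψ e
freeₚ⇒occursₚ k u (φ ⇒' ψ) e = freeₚ⇒occursₚ-∨ k u φ ψ e
freeₚ⇒occursₚ k u (φ ⇔' ψ) e = freeₚ⇒occursₚ-∨ k u φ ψ e
freeₚ⇒occursₚ k u (∀ᵢ y φ) e = freeₚ⇒occursₚ k u φ e
freeₚ⇒occursₚ k u (∃ᵢ y φ) e = freeₚ⇒occursₚ k u φ e
freeₚ⇒occursₚ k u (∀ₚ k′ u′ φ) e =
  ∨-≡trueʳ (samePVar k u k′ u′) (freeₚ⇒occursₚ k u φ (ifFalse-≡true⁻ (samePVar k u k′ u′) e))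
freeₚ⇒occursₚ k u (∃ₚ k′ u′ φ) e =
  ∨-≡trueʳ (samePVar k u k′ u′) (freeₚ⇒occursₚ k u φ (ifFalse-≡true⁻ (samePVar k u k′ u′) e))

freeₚ⇒occursₚ-∨ k u φ ψ e with ∨-≡true⁻ (freeₚ k u φ) e
... | inj₁ eφ = ∨-≡trueˡ _ (freeₚ⇒occursₚ k u φ eφ)
... | inj₂ eψ = ∨-≡trueʳ (occursₚ k u φ) (freeₚ⇒occursₚ k u ψ eψ)

indBound : ∀ {n} → Asg → Vec ℕ n → ℕ
indBound β []       = 0
indBound β (x ∷ xs) = suc (ind β x) ⊔ indBound β xs

paramBound : Asg → Formula → ℕ
paramBound β (atom k u xs) = support (prd β k u) ⊔ indBound β xs
paramBound β (¬' φ)        = paramBound β φ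
paramBound β (φ ∧' ψ)      = paramBound β φ ⊔ paramBound β ψ
paramBound β (φ ∨' ψ)      = paramBound β φ ⊔ paramBound β ψ
paramBound β (φ ⇒' ψ)      = paramBound β φ ⊔ paramBound β ψ
paramBound β (φ ⇔' ψ)      = paramBound β φ ⊔ paramBound β ψ
paramBound β (∀ᵢ y φ)      = paramBound β φ
paramBound β (∃ᵢ y φ)      = paramBound β φ
paramBound β (∀ₚ k u φ)    = paramBound β φ
paramBound β (∃ₚ k u φ)    = paramBound β φ

indBound-> : ∀ {n} β (xs : Vec ℕ n) x → anyEq x xs ≡ true → ind β x < indBound β xs
indBound-> β (y ∷ xs) x e with ∨-≡true⁻ (x ≡ᵇ y) e
... | inj₁ x≡y rewrite ≡ᵇ-≡ x y x≡y = m≤m⊔n _ (indBound β xs)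
... | inj₂ x∈xs = <-≤-trans (indBound-> β xs x x∈xs) (m≤n⊔m _ _)

⊔-≤-∨ : ∀ {a b} {c N M : ℕ} →
        (a ≡ true → c ≤ N) → (b ≡ true → c ≤ M) → a ∨ b ≡ true → c ≤ N ⊔ M
⊔-≤-∨ {a} {N = N} {M} ha hb e = [ (λ ea → ≤-trans (ha ea) (m≤m⊔n N M))
                                , (λ eb → ≤-trans (hb eb) (m≤n⊔m N M)) ] (∨-≡true⁻ a e)

paramBound-ind : ∀ β φ x → freeᵢ x φ ≡ true → ind β x < paramBound β φ
paramBound-ind β (atom k u xs) x e = <-≤-trans (indBound-> β xs x e) (m≤n⊔m _ _)
paramBound-ind β (¬' φ)     x e = paramBound-ind β φ x e
paramBound-ind β (φ ∧' ψ)   x e = ⊔-≤-∨ (paramBound-ind β φ x) (paramBound-ind β ψ x) e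
paramBound-ind β (φ ∨' ψ)   x e = ⊔-≤-∨ (paramBound-ind β φ x) (paramBound-ind β ψ x) e
paramBound-ind β (φ ⇒' ψ)   x e = ⊔-≤-∨ (paramBound-ind β φ x) (paramBound-ind β ψ x) e
paramBound-ind β (φ ⇔' ψ)   x e = ⊔-≤-∨ (paramBound-ind β φ x) (paramBound-ind β ψ x) e
paramBound-ind β (∀ᵢ y φ)   x e = paramBound-ind β φ x (ifFalse-≡true⁻ (y ≡ᵇ x) e)
paramBound-ind β (∃ᵢ y φ)   x e = paramBound-ind β φ x (ifFalse-≡true⁻ (y ≡ᵇ x) e)
paramBound-ind β (∀ₚ k u φ) x e = paramBound-ind β φ x e
paramBound-ind β (∃ₚ k u φ) x e = paramBound-ind β φ x e

paramBound-prd : ∀ β φ k u → freeₚ k u φ ≡ true → support (prd β k u) ≤ paramBound β φ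
paramBound-prd β (atom k′ u′ xs) k u e with samePVar-≡ k u k′ u′ e
... | refl , refl = m≤m⊔n _ _
paramBound-prd β (¬' φ)       k u e = paramBound-prd β φ k u e
paramBound-prd β (φ ∧' ψ)     k u e = ⊔-≤-∨ (paramBound-prd β φ k u) (paramBound-prd β ψ k u) e
paramBound-prd β (φ ∨' ψ)     k u e = ⊔-≤-∨ (paramBound-prd β φ k u) (paramBound-prd β ψ k u) e
paramBound-prd β (φ ⇒' ψ)     k u e = ⊔-≤-∨ (paramBound-prd β φ k u) (paramBound-prd β ψ k u) e
paramBound-prd β (φ ⇔' ψ)     k u e = ⊔-≤-∨ (paramBound-prd β φ k u) (paramBound-prd β ψ k u) e
paramBound-prd β (∀ᵢ y φ)     k u e = paramBound-prd β φ k u e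
paramBound-prd β (∃ᵢ y φ)     k u e = paramBound-prd β φ k u e
paramBound-prd β (∀ₚ k′ u′ φ) k u e = paramBound-prd β φ k u (ifFalse-≡true⁻ (samePVar k u k′ u′) e)
paramBound-prd β (∃ₚ k′ u′ φ) k u e = paramBound-prd β φ k u (ifFalse-≡true⁻ (samePVar k u k′ u′) e)

-- Invariance of truth under permutations

record Tracks (π : ℕ ↔ ℕ) (fᵢ : ℕ → Bool) (fₚ : ℕ → ℕ → Bool) (β β′ : Asg) : Set where
  constructor _,_
  field
    tracks-ind : ∀ x → fᵢ x ≡ true → to π (ind β x) ≡ ind β′ x
    tracks-prd : ∀ k u → fₚ k u ≡ true → ∀ w → ev (prd β′ k u) (map (to π) w) ≡ ev (prd β k u) w
open Tracks

Corresponds : ℕ ↔ ℕ → Formula → Asg → Asg → Set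
Corresponds π φ = Tracks π (λ x → freeᵢ x φ) (λ k u → freeₚ k u φ)

module _ {π : ℕ ↔ ℕ} {β β′ : Asg} where

  Tracks-∨ˡ : ∀ {fᵢ gᵢ : ℕ → Bool} {fₚ gₚ : ℕ → ℕ → Bool} →
    Tracks π (λ x → fᵢ x ∨ gᵢ x) (λ k u → fₚ k u ∨ gₚ k u) β β′ → Tracks π fᵢ fₚ β β′
  Tracks-∨ˡ {gᵢ = gᵢ} {gₚ = gₚ} (tᵢ , tₚ) =
    (λ x e → tᵢ x (∨-≡trueˡ (gᵢ x) e)) , (λ k u e → tₚ k u (∨-≡trueˡ (gₚ k u) e))

  Tracks-∨ʳ : ∀ {fᵢ gᵢ : ℕ → Bool} {fₚ gₚ : ℕ → ℕ → Bool} →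
    Tracks π (λ x → fᵢ x ∨ gᵢ x) (λ k u → fₚ k u ∨ gₚ k u) β β′ → Tracks π gᵢ gₚ β β′
  Tracks-∨ʳ {fᵢ} {fₚ = fₚ} (tᵢ , tₚ) =
    (λ x e → tᵢ x (∨-≡trueʳ (fᵢ x) e)) , (λ k u e → tₚ k u (∨-≡trueʳ (fₚ k u) e))

  Tracks-updᵢ : ∀ {fᵢ : ℕ → Bool} {fₚ : ℕ → ℕ → Bool} y {a b} →
    Tracks π (λ x → if y ≡ᵇ x then false else fᵢ x) fₚ β β′ → to π a ≡ b →
    Tracks π fᵢ fₚ (updᵢ 𝔐 β y a) (updᵢ 𝔐 β′ y b)
  Tracks-updᵢ {fᵢ} y {a} {b} (tᵢ , tₚ) πa≡b = tᵢ′ , tₚ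
    where
    tᵢ′ : ∀ x → fᵢ x ≡ true → to π (if y ≡ᵇ x then a else ind β x) ≡ (if y ≡ᵇ x then b else ind β′ x)
    tᵢ′ x e with y ≡ᵇ x | tᵢ x
    ... | true  | _  = πa≡b
    ... | false | tx = tx e

  Tracks-updₚ : ∀ {fᵢ : ℕ → Bool} {fₚ : ℕ → ℕ → Bool} k u {Q Q′ : Elem k} →
    Tracks π fᵢ (λ k′ u′ → if samePVar k′ u′ k u then false else fₚ k′ u′) β β′ →
    (∀ w → ev Q′ (map (to π) w) ≡ ev Q w) →
    Tracks π fᵢ fₚ (updₚ 𝔐 β k u Q) (updₚ 𝔐 β′ k u Q′)
  Tracks-updₚ {fₚ = fₚ} k u {Q} {Q′} (tᵢ , tₚ) Q′∼Q = tᵢ , tₚ′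
    where
    tₚ′ : ∀ k′ u′ → fₚ k′ u′ ≡ true →
          ∀ w → ev (updPrd 𝔐 (prd β′) k u Q′ k′ u′) (map (to π) w)
              ≡ ev (updPrd 𝔐 (prd β) k u Q k′ u′) w
    tₚ′ k′ u′ e with k ≟ k′ | u ≟ u′
    ... | yes refl | yes refl = Q′∼Q
    ... | yes refl | no u≢u′ =
      tₚ k′ u′ (ifFalse-≡true (samePVar-≢ k′ u′ k u (λ (_ , u′≡u) → u≢u′ (sym u′≡u))) e)
    ... | no k≢k′  | _       =
      tₚ k′ u′ (ifFalse-≡true (samePVar-≢ k′ u′ k u (λ (k′≡k , _) → k≢k′ (sym k′≡k))) e)

∀-cong-⇔ : ∀ {A B : Set} {P : A → Set} {Q : B → Set} (f : A → B) (g : B → A) →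
  (∀ a → P a ⇔ Q (f a)) → (∀ b → P (g b) ⇔ Q b) → ((a : A) → P a) ⇔ ((b : B) → Q b)
∀-cong-⇔ f g P⇔Qf Pg⇔Q = mk⇔ (λ p b → ⇒ (Pg⇔Q b) (p (g b))) (λ q a → ⇐ (P⇔Qf a) (q (f a)))

∃-cong-⇔ : ∀ {A B : Set} {P : A → Set} {Q : B → Set} (f : A → B) (g : B → A) →
  (∀ a → P a ⇔ Q (f a)) → (∀ b → P (g b) ⇔ Q b) → Σ A P ⇔ Σ B Q
∃-cong-⇔ f g P⇔Qf Pg⇔Q =
  mk⇔ (λ (a , p) → f a , ⇒ (P⇔Qf a) p) (λ (b , q) → g b , ⇐ (Pg⇔Q b) q)

map-Tracks : ∀ {n} π {fᵢ fₚ β β′} (xs : Vec ℕ n) → Tracks π fᵢ fₚ β β′ →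
  (∀ x → anyEq x xs ≡ true → fᵢ x ≡ true) → map (ind β′) xs ≡ map (to π) (map (ind β) xs)
map-Tracks π []       _ _ = refl
map-Tracks π (x ∷ xs) t sub =
  cong₂ _∷_ (sym (tracks-ind t x (sub x (∨-≡trueˡ _ (≡ᵇ-refl x)))))
            (map-Tracks π xs t (λ y e → sub y (∨-≡trueʳ (y ≡ᵇ x) e)))

⊨-transport : ∀ φ π {β β′} → Corresponds π φ β β′ → (β ⊨ φ) ⇔ (β′ ⊨ φ)
⊨-transport (atom k u xs) π {β} {β′} t = mk⇔ (trans (sym same)) (trans same)
  where
  open ≡-Reasoning
  same : ev (prd β k u) (map (ind β) xs) ≡ ev (prd β′ k u) (map (ind β′) xs)
  same = begin
    ev (prd β k u) (map (ind β) xs)                ≡⟨ tracks-prd t k u (samePVar-refl k u) _ ⟨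
    ev (prd β′ k u) (map (to π) (map (ind β) xs))  ≡⟨ cong (ev (prd β′ k u)) (map-Tracks π xs t (λ _ e → e)) ⟨
    ev (prd β′ k u) (map (ind β′) xs)              ∎
⊨-transport (¬' φ)   π t = ¬-cong-⇔ (⊨-transport φ π t)
⊨-transport (φ ∧' ψ) π t = ⊨-transport φ π (Tracks-∨ˡ t) ×-⇔ ⊨-transport ψ π (Tracks-∨ʳ t)
⊨-transport (φ ∨' ψ) π t = ⊨-transport φ π (Tracks-∨ˡ t) ⊎-⇔ ⊨-transport ψ π (Tracks-∨ʳ t)
⊨-transport (φ ⇒' ψ) π t = →-cong-⇔ (⊨-transport φ π (Tracks-∨ˡ t)) (⊨-transport ψ π (Tracks-∨ʳ t))
⊨-transport (φ ⇔' ψ) π {β} {β′} t = →-cong-⇔ φ⇔ ψ⇔ ×-⇔ →-cong-⇔ ψ⇔ φ⇔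
  where
  φ⇔ : (β ⊨ φ) ⇔ (β′ ⊨ φ)
  φ⇔ = ⊨-transport φ π (Tracks-∨ˡ t)
  ψ⇔ : (β ⊨ ψ) ⇔ (β′ ⊨ ψ)
  ψ⇔ = ⊨-transport ψ π (Tracks-∨ʳ t)
⊨-transport (∀ᵢ y φ) π t = ∀-cong-⇔ (to π) (from π)
  (λ a → ⊨-transport φ π (Tracks-updᵢ y t refl))
  (λ b → ⊨-transport φ π (Tracks-updᵢ y t (strictlyInverseˡ π b)))
⊨-transport (∃ᵢ y φ) π t = ∃-cong-⇔ (to π) (from π)
  (λ a → ⊨-transport φ π (Tracks-updᵢ y t refl))
  (λ b → ⊨-transport φ π (Tracks-updᵢ y t (strictlyInverseˡ π b)))
⊨-transport (∀ₚ k u φ) π t = ∀-cong-⇔ (push π) (pull π)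
  (λ Q → ⊨-transport φ π (Tracks-updₚ k u t (cong (ev Q) ∘ map-from-to π)))
  (λ Q → ⊨-transport φ π (Tracks-updₚ k u t (λ _ → refl)))
⊨-transport (∃ₚ k u φ) π t = ∃-cong-⇔ (push π) (pull π)
  (λ Q → ⊨-transport φ π (Tracks-updₚ k u t (cong (ev Q) ∘ map-from-to π)))
  (λ Q → ⊨-transport φ π (Tracks-updₚ k u t (λ _ → refl)))

updᵢ* : ∀ {n} → Asg → Vec ℕ n → Vec ℕ n → Asg
updᵢ* β []       []      = β
updᵢ* β (x ∷ xs) (a ∷ v) = updᵢ* (updᵢ 𝔐 β x a) xs v

⊨∀ᵢ* : ∀ {n} (xs : Vec ℕ n) ψ β → (β ⊨ ∀ᵢ* xs ψ) ⇔ ((v : Vec ℕ n) → updᵢ* β xs v ⊨ ψ)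
⊨∀ᵢ* []       ψ β = mk⇔ (λ p → λ { [] → p }) (λ h → h [])
⊨∀ᵢ* (x ∷ xs) ψ β = mk⇔
  (λ p → λ { (a ∷ v) → ⇒ (⊨∀ᵢ* xs ψ (updᵢ 𝔐 β x a)) (p a) v })
  (λ h a → ⇐ (⊨∀ᵢ* xs ψ (updᵢ 𝔐 β x a)) (λ v → h (a ∷ v)))

prd-updᵢ* : ∀ {n} β (xs v : Vec ℕ n) → prd (updᵢ* β xs v) ≡ prd β
prd-updᵢ* β []       []      = refl
prd-updᵢ* β (x ∷ xs) (a ∷ v) = prd-updᵢ* (updᵢ 𝔐 β x a) xs v

ind-updᵢ*-map : ∀ {n} (h : ℕ → ℕ) β β′ (xs v : Vec ℕ n) x → h (ind β x) ≡ ind β′ x →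
  h (ind (updᵢ* β xs v) x) ≡ ind (updᵢ* β′ xs (map h v)) x
ind-updᵢ*-map h β β′ []       []      x e = e
ind-updᵢ*-map h β β′ (y ∷ xs) (a ∷ v) x e =
  ind-updᵢ*-map h (updᵢ 𝔐 β y a) (updᵢ 𝔐 β′ y (h a)) xs v x (h-if (y ≡ᵇ x))
  where h-if : ∀ c → h (if c then a else ind β x) ≡ (if c then h a else ind β′ x)
        h-if true  = refl
        h-if false = e

∨-≡false⁻ʳ : ∀ a {b} → a ∨ b ≡ false → b ≡ false
∨-≡false⁻ʳ false e = e

ind-updᵢ*-≗ : ∀ {n} β β′ (xs v : Vec ℕ n) → (∀ x → ind β x ≡ ind β′ x) →
  ∀ x → ind (updᵢ* β xs v) x ≡ ind (updᵢ* β′ xs v) x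
ind-updᵢ*-≗ β β′ xs v β≗β′ x =
  trans (ind-updᵢ*-map id β β′ xs v x (β≗β′ x)) (cong (λ u → ind (updᵢ* β′ xs u) x) (map-id v))

updᵢ*-++ : ∀ {n m} β (xs v : Vec ℕ n) (ys w : Vec ℕ m) →
           updᵢ* β (xs ++ ys) (v ++ w) ≡ updᵢ* (updᵢ* β xs v) ys w
updᵢ*-++ β []       []      ys w = refl
updᵢ*-++ β (x ∷ xs) (a ∷ v) ys w = updᵢ*-++ (updᵢ 𝔐 β x a) xs v ys w

ind-updᵢ*-∉ : ∀ {n} β (xs v : Vec ℕ n) x → anyEq x xs ≡ false → ind (updᵢ* β xs v) x ≡ ind β x
ind-updᵢ*-∉ β []       []      x _ = refl
ind-updᵢ*-∉ β (y ∷ xs) (a ∷ v) x e with y ≟ x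
... | yes refl = contradiction (trans (sym (∨-≡trueˡ (anyEq y xs) (≡ᵇ-refl y))) e) λ ()
... | no y≢x   = trans (ind-updᵢ*-∉ (updᵢ 𝔐 β y a) xs v x (∨-≡false⁻ʳ (x ≡ᵇ y) e))
                       (cong (λ c → if c then a else ind β x) (dec-false (y ≟ x) y≢x))

anyEq-≡false : ∀ {n} x (ys : Vec ℕ n) → (∀ j → x ≢ lookup ys j) → anyEq x ys ≡ false
anyEq-≡false x []       _   = refl
anyEq-≡false x (y ∷ ys) x∉ =
  cong₂ _∨_ (dec-false (x ≟ y) (x∉ zero)) (anyEq-≡false x ys (x∉ ∘ suc))

Distinct-head : ∀ {n} {y} {xs : Vec ℕ n} → Distinct (y ∷ xs) → anyEq y xs ≡ false
Distinct-head {y = y} {xs} d = anyEq-≡false y xs (λ j y≡xⱼ → contradiction (d zero (suc j) y≡xⱼ) λ ())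

Distinct-tail : ∀ {n} {y} {xs : Vec ℕ n} → Distinct (y ∷ xs) → Distinct xs
Distinct-tail d i j e = Finₚ.suc-injective (d (suc i) (suc j) e)

map-ind-updᵢ* : ∀ {n} β (xs v : Vec ℕ n) → Distinct xs → map (ind (updᵢ* β xs v)) xs ≡ v
map-ind-updᵢ* β []       []      _ = refl
map-ind-updᵢ* β (y ∷ xs) (a ∷ v) d = cong₂ _∷_
  (trans (ind-updᵢ*-∉ (updᵢ 𝔐 β y a) xs v y (Distinct-head d))
         (cong (λ c → if c then a else ind β y) (≡ᵇ-refl y)))
  (map-ind-updᵢ* (updᵢ 𝔐 β y a) xs v (Distinct-tail d))

updPrd-same : ∀ (ρ : ∀ k u → Elem k) k u P → updPrd 𝔐 ρ k u P k u ≡ P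
updPrd-same ρ k u P with k ≟ k | u ≟ u
... | yes refl | yes _ = refl
... | yes refl | no u≢u = contradiction refl u≢u
... | no k≢k   | _      = contradiction refl k≢k

updPrd-other : ∀ (ρ : ∀ k u → Elem k) k u P k′ u′ → ¬ (k ≡ k′ × u ≡ u′) →
               updPrd 𝔐 ρ k u P k′ u′ ≡ ρ k′ u′
updPrd-other ρ k u P k′ u′ ne with k ≟ k′ | u ≟ u′
... | yes refl | yes u≡u′ = contradiction (refl , u≡u′) ne
... | yes refl | no _     = refl
... | no _     | _        = refl

-- Comprehension

⊨-fixing : ∀ {n} G β (xs v : Vec ℕ n) π → Fixes π (paramBound β G) →
  (updᵢ* β xs v ⊨ G) ⇔ (updᵢ* β xs (map (to π) v) ⊨ G)
⊨-fixing G β xs v π fix = ⊨-transport G π (tᵢ , tₚ)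
  where
  tᵢ : ∀ x → freeᵢ x G ≡ true → to π (ind (updᵢ* β xs v) x) ≡ ind (updᵢ* β xs (map (to π) v)) x
  tᵢ x fr = ind-updᵢ*-map (to π) β β xs v x (fix _ (paramBound-ind β G x fr))
  tₚ : ∀ k u → freeₚ k u G ≡ true → ∀ w →
       ev (prd (updᵢ* β xs (map (to π) v)) k u) (map (to π) w) ≡ ev (prd (updᵢ* β xs v) k u) w
  tₚ k u fr w rewrite prd-updᵢ* β xs v | prd-updᵢ* β xs (map (to π) v) =
    supported (prd β k u) π (Fixes-≤ π (paramBound-prd β G k u fr) fix) w

does-cong : (lem : ExcludedMiddle 0ℓ) {A B : Set} → A ⇔ B → does (lem {A}) ≡ does (lem {B})
does-cong lem A⇔B = does-≡ (Dec.map A⇔B lem) lem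

does-≡true⇔ : ∀ {A : Set} (a? : Dec A) → (does a? ≡ true) ⇔ A
does-≡true⇔ (yes a) = mk⇔ (λ _ → a) (λ _ → refl)
does-≡true⇔ (no ¬a) = mk⇔ (λ ()) (λ a → contradiction a ¬a)

comprehension : ExcludedMiddle 0ℓ → HenkinAsser 𝔐
comprehension lem ._ (k , A , xs , G , distinct , A∉G , refl) β = P , ⇐ (⊨∀ᵢ* xs _ βP) defines
  where
  holds : Vec ℕ (suc k) → Set
  holds v = updᵢ* β xs v ⊨ G
  P : Elem k
  P = (λ v → does (lem {holds v})) , paramBound β G ,
      λ π fix v → sym (does-cong lem (⊨-fixing G β xs v π fix))
  βP : Asg
  βP = updₚ 𝔐 β k A P
  defines : ∀ v → updᵢ* βP xs v ⊨ (atom k A xs ⇔' G)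
  defines v = ⇒ atom⇔G , ⇐ atom⇔G
    where
    γ : Asg
    γ = updᵢ* βP xs v
    atom⇔ : (ev (prd γ k A) (map (ind γ) xs) ≡ true) ⇔ (does (lem {holds v}) ≡ true)
    atom⇔ rewrite prd-updᵢ* βP xs v | updPrd-same (prd β) k A P | map-ind-updᵢ* βP xs v distinct = ⇔-refl
    tᵢ : ∀ x → freeᵢ x G ≡ true → ind (updᵢ* β xs v) x ≡ ind γ x
    tᵢ x _ = ind-updᵢ*-≗ β βP xs v (λ _ → refl) x
    tₚ : ∀ k′ u′ → freeₚ k′ u′ G ≡ true → ∀ w →
         ev (prd γ k′ u′) (map id w) ≡ ev (prd (updᵢ* β xs v) k′ u′) w
    tₚ k′ u′ fr w rewrite prd-updᵢ* βP xs v | prd-updᵢ* β xs v | map-id w =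
      cong (λ Q → ev Q w) (updPrd-other (prd β) k A P k′ u′ λ where
        (refl , refl) → contradiction (trans (sym fr) A∉G) λ ())
    atom⇔G : (γ ⊨ atom k A xs) ⇔ (γ ⊨ G)
    atom⇔G = ⇔-trans atom⇔ (⇔-trans (does-≡true⇔ lem) (⊨-transport G ↔-refl (tᵢ , tₚ)))

-- Failure of the well-ordering principle

swap : ℕ → ℕ → ℕ → ℕ
swap a b z with z ≟ a | z ≟ b
... | yes _ | _     = b
... | no _  | yes _ = a
... | no _  | no _  = z

swap-left : ∀ a b → swap a b a ≡ b
swap-left a b with a ≟ a
... | yes _   = refl
... | no a≢a = contradiction refl a≢a

swap-right : ∀ a b → swap a b b ≡ a
swap-right a b with b ≟ a | b ≟ b
... | yes refl | _       = refl
... | no _     | yes _   = refl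
... | no _     | no b≢b = contradiction refl b≢b

swap-other : ∀ a b z → z ≢ a → z ≢ b → swap a b z ≡ z
swap-other a b z z≢a z≢b with z ≟ a | z ≟ b
... | yes z≡a | _       = contradiction z≡a z≢a
... | no _    | yes z≡b = contradiction z≡b z≢b
... | no _    | no _    = refl

swap-involutive : ∀ a b z → swap a b (swap a b z) ≡ z
swap-involutive a b z with z ≟ a | z ≟ b
... | yes refl | _        = swap-right z b
... | no _     | yes refl = swap-left a z
... | no z≢a   | no z≢b   = swap-other a b z z≢a z≢b

transposition : ℕ → ℕ → ℕ ↔ ℕ
transposition a b = mk↔ₛ′ (swap a b) (swap a b) (swap-involutive a b) (swap-involutive a b)

singleton : ℕ → Elem 0
singleton a = (λ w → head w ≡ᵇ a) , suc a , supp
  where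
  supp : SupportedBy 0 (λ w → head w ≡ᵇ a) (suc a)
  supp π fix (z ∷ []) = does-≡ (Dec.map (mk⇔ πz≡a⇒z≡a (λ { refl → fix a ≤-refl })) (to π z ≟ a)) (z ≟ a)
    where
    πz≡a⇒z≡a : to π z ≡ a → z ≡ a
    πz≡a⇒z≡a πz≡a = trans (sym (fixed-preimage π fix (≤-reflexive (cong suc πz≡a)))) πz≡a

full : Elem 0
full = (λ _ → true) , 0 , λ _ _ _ → refl

¬wellOrdering : ModelOf 𝔐 (_≡ ¬' WO¹)
¬wellOrdering ._ refl β wo¹ with wo¹ full
... | T , (_ , antisymmetric , _ , total , _) = 1+n≢n N+1≡N
  where
  N : ℕ
  N = support T
  T-symmetric : ev T (suc N ∷ N ∷ []) ≡ ev T (N ∷ suc N ∷ [])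
  T-symmetric = trans (cong (ev T) (cong₂ (λ x y → x ∷ y ∷ []) (sym (swap-left N (suc N))) (sym (swap-right N (suc N)))))
    (supported T (transposition N (suc N))
      (λ i i<N → swap-other N (suc N) i (<⇒≢ i<N) (<⇒≢ (m<n⇒m<1+n i<N))) (N ∷ suc N ∷ []))
  both : ev T (N ∷ suc N ∷ []) ≡ true × ev T (suc N ∷ N ∷ []) ≡ true
  both with total N (suc N) (refl , refl)
  ... | inj₁ e = e , trans T-symmetric e
  ... | inj₂ e = trans (sym T-symmetric) e , e
  N+1≡N : suc N ≡ N
  N+1≡N = ≡ᵇ-≡ (suc N) N (proj₁ (antisymmetric N (suc N) (refl , refl , both) (singleton N)) (≡ᵇ-refl N))

-- Choice

first : ∀ {n} {P : Fin (suc n) → Set} → Decidable P → Fin (suc n)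
first {zero}  P? = zero
first {suc n} P? with P? zero
... | yes _ = zero
... | no  _ = suc (first (P? ∘ suc))

first-satisfies : ∀ {n} {P : Fin (suc n) → Set} (P? : Decidable P) {i} → P i → P (first P?)
first-satisfies {zero}  P? {zero} p = p
first-satisfies {suc n} P? {i} p with P? zero | i
... | yes p₀ | _     = p₀
... | no ¬p₀ | zero  = contradiction p ¬p₀
... | no _   | suc j = first-satisfies (P? ∘ suc) p

first-cong : ∀ {n} {P Q : Fin (suc n) → Set} (P? : Decidable P) (Q? : Decidable Q) →
  (∀ i → P i ⇔ Q i) → first P? ≡ first Q?
first-cong {zero}  P? Q? P⇔Q = refl
first-cong {suc n} P? Q? P⇔Q with P? zero | Q? zero
... | yes _  | yes _  = refl
... | no _   | no _   = cong suc (first-cong (P? ∘ suc) (Q? ∘ suc) (P⇔Q ∘ suc))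
... | yes p  | no ¬q  = contradiction (⇒ (P⇔Q zero) p) ¬q
... | no ¬p  | yes q  = contradiction (⇐ (P⇔Q zero) q) ¬p

module Exchange {n} {O : Fin n → Set} (O? : Decidable O) (a b : Fin n → ℕ) where

  data Position (z : ℕ) : Set where
    left  : ∀ i → O i → a i ≡ z → Position z
    right : ∀ i → O i → b i ≡ z → Position z
    fixed : (∀ i → O i → a i ≢ z) → (∀ i → O i → b i ≢ z) → Position z

  position : ∀ z → Position z
  position z with any? (λ i → O? i ×-dec (a i ≟ z)) | any? (λ i → O? i ×-dec (b i ≟ z))
  ... | yes (i , o , e) | _               = left i o e
  ... | no _            | yes (i , o , e) = right i o e
  ... | no ¬l           | no ¬r           = fixed (λ i o e → ¬l (i , o , e)) (λ i o e → ¬r (i , o , e))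

  exchange : ℕ → ℕ
  exchange z with position z
  ... | left i _ _  = b i
  ... | right i _ _ = a i
  ... | fixed _ _   = z

module ExchangeProperties {n} {O : Fin n → Set} (O? : Decidable O) (a b : Fin n → ℕ)
  (a-injective : ∀ {i j} → O i → O j → a i ≡ a j → i ≡ j)
  (b-injective : ∀ {i j} → b i ≡ b j → i ≡ j)
  (a≢b : ∀ {i j} → O i → O j → a i ≢ b j)
  where
  open Exchange O? a b

  exchange-left : ∀ {i} → O i → exchange (a i) ≡ b i
  exchange-left {i} o with position (a i)
  ... | left j oj e  = cong b (a-injective oj o e)
  ... | right j oj e = contradiction (sym e) (a≢b o oj)
  ... | fixed ¬l _   = contradiction refl (¬l i o)

  exchange-right : ∀ {i} → O i → exchange (b i) ≡ a i
  exchange-right {i} o with position (b i)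
  ... | left j oj e  = contradiction e (a≢b oj o)
  ... | right j oj e = cong a (b-injective e)
  ... | fixed _ ¬r   = contradiction refl (¬r i o)

  exchange-fixed : ∀ {z} → (∀ i → O i → a i ≢ z) → (∀ i → O i → b i ≢ z) → exchange z ≡ z
  exchange-fixed {z} ¬l ¬r with position z
  ... | left i o e  = contradiction e (¬l i o)
  ... | right i o e = contradiction e (¬r i o)
  ... | fixed _ _   = refl

  exchange-involutive : ∀ z → exchange (exchange z) ≡ z
  exchange-involutive z with position z
  ... | left i o refl  = exchange-right o
  ... | right i o refl = exchange-left o
  ... | fixed ¬l ¬r    = exchange-fixed ¬l ¬r

  exchange-equivariant : ∀ {O′ : Fin n → Set} (O′? : Decidable O′) (a′ b′ : Fin n → ℕ) (h : ℕ → ℕ) →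
    (∀ {x y} → h x ≡ h y → x ≡ y) → (∀ i → O′ i ⇔ O i) →
    (∀ i → a′ i ≡ h (a i)) → (∀ i → b′ i ≡ h (b i)) →
    ∀ z → Exchange.exchange O′? a′ b′ (h z) ≡ h (exchange z)
  exchange-equivariant O′? a′ b′ h h-injective O′⇔O a′≡ha b′≡hb z with position z
  ... | left i o refl with Exchange.position O′? a′ b′ (h (a i))
  ...   | left j o′ e  =
    trans (b′≡hb j) (cong (h ∘ b) (a-injective (⇒ (O′⇔O j) o′) o (h-injective (trans (sym (a′≡ha j)) e))))
  ...   | right j o′ e =
    contradiction (h-injective (trans (sym (b′≡hb j)) e)) (≢-sym (a≢b o (⇒ (O′⇔O j) o′)))
  ...   | fixed ¬l _   = contradiction (a′≡ha i) (¬l i (⇐ (O′⇔O i) o))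
  exchange-equivariant O′? a′ b′ h h-injective O′⇔O a′≡ha b′≡hb z
      | right i o refl with Exchange.position O′? a′ b′ (h (b i))
  ...   | left j o′ e  =
    contradiction (h-injective (trans (sym (a′≡ha j)) e)) (a≢b (⇒ (O′⇔O j) o′) o)
  ...   | right j o′ e =
    trans (a′≡ha j) (cong (h ∘ a) (b-injective (h-injective (trans (sym (b′≡hb j)) e))))
  ...   | fixed _ ¬r   = contradiction (b′≡hb i) (¬r i (⇐ (O′⇔O i) o))
  exchange-equivariant O′? a′ b′ h h-injective O′⇔O a′≡ha b′≡hb z
      | fixed ¬l ¬r with Exchange.position O′? a′ b′ (h z)
  ...   | left j o′ e  =
    contradiction (h-injective (trans (sym (a′≡ha j)) e)) (¬l j (⇒ (O′⇔O j) o′))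
  ...   | right j o′ e =
    contradiction (h-injective (trans (sym (b′≡hb j)) e)) (¬r j (⇒ (O′⇔O j) o′))
  ...   | fixed _ _    = refl

map-fixing-entries : ∀ {n} (f : ℕ → ℕ) (v : Vec ℕ n) → (∀ i → f (lookup v i) ≡ lookup v i) → map f v ≡ v
map-fixing-entries f []      _   = refl
map-fixing-entries f (x ∷ v) fix = cong₂ _∷_ (fix zero) (map-fixing-entries f v (fix ∘ suc))

-- Entries of v below N₀ are kept; the others are moved to the slots of the first of the
-- n + 1 blocks [N₀ + j n, N₀ + (j + 1) n) that v misses, indexed by their first occurrence.
module Canonical (N₀ n′ : ℕ) where

  n : ℕ
  n = suc n′

  M : ℕ
  M = N₀ + suc n * n

  lo : Fin (suc n) → ℕ
  lo j = N₀ + toℕ j * n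

  lo+n : ∀ j → lo j + n ≡ N₀ + suc (toℕ j) * n
  lo+n j = trans (+-assoc N₀ (toℕ j * n) n) (cong (N₀ +_) (+-comm (toℕ j * n) n))

  InBlock : Fin (suc n) → ℕ → Set
  InBlock j x = lo j ≤ x × x < lo j + n

  InBlock-< : ∀ j {x} → InBlock j x → x < M
  InBlock-< j (_ , x<) = <-≤-trans x< (begin
    lo j + n                ≡⟨ lo+n j ⟩
    N₀ + suc (toℕ j) * n    ≤⟨ +-monoʳ-≤ N₀ (*-monoˡ-≤ n (Finₚ.toℕ<n j)) ⟩
    M                       ∎)
    where open ≤-Reasoning

  InBlock-disjoint : ∀ i j {x} → toℕ i < toℕ j → InBlock i x → InBlock j x → ⊥
  InBlock-disjoint i j {x} i<j (_ , x<) (le , _) = <-irrefl refl (begin-strict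
    x                       <⟨ x< ⟩
    lo i + n                ≡⟨ lo+n i ⟩
    N₀ + suc (toℕ i) * n    ≤⟨ +-monoʳ-≤ N₀ (*-monoˡ-≤ n i<j) ⟩
    lo j                    ≤⟨ le ⟩
    x                       ∎)
    where open ≤-Reasoning

  Hits : Vec ℕ n → Fin (suc n) → Set
  Hits v j = ∃ λ i → InBlock j (lookup v i)

  hits? : ∀ v → Decidable (Hits v)
  hits? v j = any? (λ i → (lo j ≤? lookup v i) ×-dec (lookup v i <? lo j + n))

  some-block-missed : ∀ v → ¬ (∀ j → Hits v j)
  some-block-missed v hit with Finₚ.pigeonhole (n<1+n n) (proj₁ ∘ hit)
  ... | i , j , i<j , same =
    InBlock-disjoint i j i<j (proj₂ (hit i)) (subst (InBlock j ∘ lookup v) (sym same) (proj₂ (hit j)))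

  freeBlock : Vec ℕ n → Fin (suc n)
  freeBlock v = first (¬? ∘ hits? v)

  freeBlock-missed : ∀ v → ¬ Hits v (freeBlock v)
  freeBlock-missed v with Finₚ.¬∀⟶∃¬ (suc n) (Hits v) (hits? v) (some-block-missed v)
  ... | j , missed = first-satisfies (¬? ∘ hits? v) {j} missed

  slot : Vec ℕ n → Fin n → ℕ
  slot v i = lo (freeBlock v) + toℕ i

  slot-InBlock : ∀ v i → InBlock (freeBlock v) (slot v i)
  slot-InBlock v i = m≤m+n _ (toℕ i) , +-monoʳ-< _ (Finₚ.toℕ<n i)

  slot-injective : ∀ v {i j} → slot v i ≡ slot v j → i ≡ j
  slot-injective v e = Finₚ.toℕ-injective (+-cancelˡ-≡ _ _ _ e)

  N₀≤slot : ∀ v i → N₀ ≤ slot v i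
  N₀≤slot v i = ≤-trans (m≤m+n N₀ _) (m≤m+n _ (toℕ i))

  lookup≢slot : ∀ v i j → lookup v i ≢ slot v j
  lookup≢slot v i j e = freeBlock-missed v (i , subst (InBlock (freeBlock v)) (sym e) (slot-InBlock v j))

  firstOcc : Vec ℕ n → ℕ → Fin n
  firstOcc v z = first (λ i → lookup v i ≟ z)

  firstOcc-correct : ∀ v i → lookup v (firstOcc v (lookup v i)) ≡ lookup v i
  firstOcc-correct v i = first-satisfies (λ j → lookup v j ≟ lookup v i) refl

  Occupied : Vec ℕ n → Fin n → Set
  Occupied v i = N₀ ≤ lookup v i × firstOcc v (lookup v i) ≡ i

  occupied? : ∀ v → Decidable (Occupied v)
  occupied? v i = (N₀ ≤? lookup v i) ×-dec (firstOcc v (lookup v i) Finₚ.≟ i)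

  occupied-injective : ∀ v {i j} → Occupied v i → Occupied v j → lookup v i ≡ lookup v j → i ≡ j
  occupied-injective v (_ , fi) (_ , fj) e = trans (sym fi) (trans (cong (firstOcc v) e) fj)

  module σ-Properties (v : Vec ℕ n) = ExchangeProperties (occupied? v) (lookup v) (slot v)
    (occupied-injective v) (slot-injective v) (λ {i} {j} _ _ → lookup≢slot v i j)

  -- Swaps every large entry of v (at its first occurrence i) with the slot i of the free block.
  opaque
    σ : Vec ℕ n → ℕ → ℕ
    σ v = Exchange.exchange (occupied? v) (lookup v) (slot v)

    σ-involutive : ∀ v z → σ v (σ v z) ≡ z
    σ-involutive v = σ-Properties.exchange-involutive v

    σ-slot : ∀ v {i} → Occupied v i → σ v (slot v i) ≡ lookup v i
    σ-slot v = σ-Properties.exchange-right v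

    σ-below : ∀ v {z} → z < N₀ → σ v z ≡ z
    σ-below v z<N₀ = σ-Properties.exchange-fixed v
      (λ i (N₀≤vᵢ , _) e → <⇒≱ z<N₀ (subst (N₀ ≤_) e N₀≤vᵢ))
      (λ i _ e → <⇒≱ z<N₀ (subst (N₀ ≤_) e (N₀≤slot v i)))

  canon : Vec ℕ n → ℕ → ℕ
  canon v x with x <? N₀
  ... | yes _ = x
  ... | no  _ = slot v (firstOcc v x)

  canonical : Vec ℕ n → Vec ℕ n
  canonical v = map (canon v) v

  canon-< : ∀ v x → canon v x < M
  canon-< v x with x <? N₀
  ... | yes x<N₀ = <-≤-trans x<N₀ (m≤m+n N₀ _)
  ... | no  _    = InBlock-< (freeBlock v) (slot-InBlock v (firstOcc v x))

  σ-canon : ∀ v i → σ v (canon v (lookup v i)) ≡ lookup v i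
  σ-canon v i with lookup v i <? N₀
  ... | yes vᵢ<N₀ = σ-below v vᵢ<N₀
  ... | no  vᵢ≮N₀ = trans (σ-slot v occupied) (firstOcc-correct v i)
    where
    j : Fin n
    j = firstOcc v (lookup v i)
    occupied : Occupied v j
    occupied = subst (N₀ ≤_) (sym (firstOcc-correct v i)) (≮⇒≥ vᵢ≮N₀)
             , cong (firstOcc v) (firstOcc-correct v i)

  σ-canonical : ∀ v → map (σ v) (canonical v) ≡ v
  σ-canonical v = trans (sym (map-∘ (σ v) (canon v) v))
                        (map-fixing-entries (σ v ∘ canon v) v (σ-canon v))

  module Equivariance (π : ℕ ↔ ℕ) (fix : Fixes π M) where

    h : ℕ → ℕ
    h = to π

    h-injective : ∀ {x y} → h x ≡ h y → x ≡ y
    h-injective = to-injective π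

    N₀≤M : N₀ ≤ M
    N₀≤M = m≤m+n N₀ _

    InBlock-map : ∀ j x → InBlock j (h x) ⇔ InBlock j x
    InBlock-map j x = mk⇔
      (λ hx∈ → subst (InBlock j) (fixed-preimage π fix (InBlock-< j hx∈)) hx∈)
      (λ x∈ → subst (InBlock j) (sym (fix x (InBlock-< j x∈))) x∈)

    Hits-map : ∀ v j → Hits (map h v) j ⇔ Hits v j
    Hits-map v j = mk⇔
      (λ (i , e) → i , ⇒ (InBlock-map j _) (subst (InBlock j) (lookup-map i h v) e))
      (λ (i , e) → i , subst (InBlock j) (sym (lookup-map i h v)) (⇐ (InBlock-map j _) e))

    slot-map : ∀ v i → slot (map h v) i ≡ slot v i
    slot-map v i = cong (λ j → lo j + toℕ i)
      (first-cong (¬? ∘ hits? (map h v)) (¬? ∘ hits? v) (¬-cong-⇔ ∘ Hits-map v))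

    firstOcc-map : ∀ v z → firstOcc (map h v) (h z) ≡ firstOcc v z
    firstOcc-map v z = first-cong (λ i → lookup (map h v) i ≟ h z) (λ i → lookup v i ≟ z) λ i →
      mk⇔ (λ e → h-injective (trans (sym (lookup-map i h v)) e)) (λ e → trans (lookup-map i h v) (cong h e))

    N₀≤-map : ∀ x → N₀ ≤ h x ⇔ N₀ ≤ x
    N₀≤-map x = mk⇔
      (λ N₀≤hx → ≮⇒≥ λ x<N₀ →
        <⇒≱ (subst (_< N₀) (sym (fix x (<-≤-trans x<N₀ N₀≤M))) x<N₀) N₀≤hx)
      (λ N₀≤x → ≮⇒≥ λ hx<N₀ →
        <⇒≱ (subst (_< N₀) (fixed-preimage π fix (<-≤-trans hx<N₀ N₀≤M)) hx<N₀) N₀≤x)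

    Occupied-map : ∀ v i → Occupied (map h v) i ⇔ Occupied v i
    Occupied-map v i = subst (λ y → (N₀ ≤ y × firstOcc (map h v) y ≡ i) ⇔ Occupied v i) (sym (lookup-map i h v))
      (N₀≤-map (lookup v i) ×-⇔ mk⇔ (trans (sym (firstOcc-map v (lookup v i)))) (trans (firstOcc-map v (lookup v i))))

    opaque
      unfolding σ

      σ-map : ∀ v z → σ (map h v) (h z) ≡ h (σ v z)
      σ-map v = σ-Properties.exchange-equivariant v (occupied? (map h v)) (lookup (map h v)) (slot (map h v)) h
        h-injective (Occupied-map v) (λ i → lookup-map i h v)
        (λ i → trans (slot-map v i) (sym (fix _ (InBlock-< (freeBlock v) (slot-InBlock v i)))))

    canon-map : ∀ v x → canon (map h v) (h x) ≡ canon v x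
    canon-map v x with h x <? N₀ | x <? N₀
    ... | yes _     | yes x<N₀  = fix x (<-≤-trans x<N₀ N₀≤M)
    ... | no _      | no _      = trans (slot-map v _) (cong (slot v) (firstOcc-map v x))
    ... | yes hx<N₀ | no x≮N₀   = contradiction (⇐ (N₀≤-map x) (≮⇒≥ x≮N₀)) (<⇒≱ hx<N₀)
    ... | no hx≮N₀  | yes x<N₀  = contradiction (⇒ (N₀≤-map x) (≮⇒≥ hx≮N₀)) (<⇒≱ x<N₀)

    canonical-map : ∀ v → canonical (map h v) ≡ canonical v
    canonical-map v = begin
      map (canon (map h v)) (map h v)  ≡⟨ map-∘ (canon (map h v)) h v ⟨
      map (canon (map h v) ∘ h) v      ≡⟨ map-cong (canon-map v) v ⟩
      map (canon v) v                  ∎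
      where open ≡-Reasoning

uncurry++ : ∀ {A B : Set} {n m} → (Vec A n → Vec A m → B) → Vec A (n + m) → B
uncurry++ {n = n} f u = f (proj₁ (splitAt n u)) (proj₁ (proj₂ (splitAt n u)))

uncurry++-++ : ∀ {A B : Set} {n m} (f : Vec A n → Vec A m → B) v w → uncurry++ f (v ++ w) ≡ f v w
uncurry++-++ {n = n} f v w with splitAt n (v ++ w)
... | v′ , w′ , eq with ++-injective v v′ eq
... | refl , refl = refl

module ChoiceInstance (n′ m′ : ℕ) (H : Formula) (xs : Vec ℕ (suc n′)) (ys : Vec ℕ (suc m′)) (D S : ℕ)
  (distinct : Distinct (xs ++ ys)) (S∉H : occursₚ (n′ + suc m′) S H ≡ false) (β : Asg)
  (witness : (v : Vec ℕ (suc n′)) → Σ (Elem m′) λ P → updₚ 𝔐 (updᵢ* β xs v) m′ D P ⊨ H)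
  where

  K : ℕ
  K = n′ + suc m′

  open Canonical (paramBound β H) n′

  F : Vec ℕ n → Elem m′
  F v = proj₁ (witness (canonical v))

  -- Canonical tuples lie below M, so only finitely many witnesses are ever used.
  N₁ : ℕ
  N₁ = M ⊔ supBelowVec M (support ∘ proj₁ ∘ witness)

  σ↔ : Vec ℕ n → ℕ ↔ ℕ
  σ↔ v = mk↔ₛ′ (σ v) (σ v) (σ-involutive v) (σ-involutive v)

  chosen : Vec ℕ n → Elem m′
  chosen v = push (σ↔ v) (F v)

  opaque
    graph : pred ℕ K
    graph = uncurry++ λ v w → ev (chosen v) w

    graph-++ : ∀ v w → graph (v ++ w) ≡ ev (chosen v) w
    graph-++ = uncurry++-++ λ v w → ev (chosen v) w

  support-F : ∀ v → support (F v) ≤ N₁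
  support-F v =
    ≤-trans (supBelowVec-≥ M (support ∘ proj₁ ∘ witness) (canonical v) canonical-<M) (m≤n⊔m M _)
    where
    canonical-<M : ∀ i → lookup (canonical v) i < M
    canonical-<M i = subst (_< M) (sym (lookup-map i (canon v) v)) (canon-< v (lookup v i))

  graph-map : ∀ π → Fixes π N₁ → ∀ v w → graph (map (to π) (v ++ w)) ≡ graph (v ++ w)
  graph-map π fix v w = begin
      graph (map (to π) (v ++ w))
    ≡⟨ cong graph (map-++ (to π) v w) ⟩
      graph (map (to π) v ++ map (to π) w)
    ≡⟨ graph-++ (map (to π) v) (map (to π) w) ⟩
      ev (chosen (map (to π) v)) (map (to π) w)
    ≡⟨ cong₂ (λ P u → ev P u) F-map map-σ-map ⟩
      ev (F v) (map (to π) (map (σ v) w))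
    ≡⟨ supported (F v) π (Fixes-≤ π (support-F v) fix) (map (σ v) w) ⟩
      ev (chosen v) w
    ≡⟨ graph-++ v w ⟨
      graph (v ++ w)
    ∎
    where
    open ≡-Reasoning
    open Equivariance π (Fixes-≤ π (m≤m⊔n M _) fix)
    F-map : F (map (to π) v) ≡ F v
    F-map = cong (proj₁ ∘ witness) (canonical-map v)
    map-σ-map : map (σ (map (to π) v)) (map (to π) w) ≡ map (to π) (map (σ v) w)
    map-σ-map = trans (sym (map-∘ (σ (map (to π) v)) (to π) w))
                      (trans (map-cong (σ-map v) w) (map-∘ (to π) (σ v) w))

  graph-supported : SupportedBy K graph N₁
  graph-supported π fix u =
    let (v , w , u≡v++w) = splitAt n u
    in subst (λ u → graph (map (to π) u) ≡ graph u) (sym u≡v++w) (graph-map π fix v w)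

  graphElem : Elem K
  graphElem = graph , N₁ , graph-supported

  βS : Asg
  βS = updₚ 𝔐 β K S graphElem

  S-unchanged : ∀ k u → freeₚ k u H ≡ true → updPrd 𝔐 (prd β) K S graphElem k u ≡ prd β k u
  S-unchanged k u fr = updPrd-other (prd β) K S graphElem k u λ where
    (refl , refl) → contradiction (trans (sym (freeₚ⇒occursₚ K S H fr)) S∉H) λ ()

  module _ (v : Vec ℕ n) where

    α : Asg
    α = updᵢ* βS xs v

    γ : Asg
    γ = updₚ 𝔐 α m′ D (chosen v)

    tracks : Tracks (σ↔ v) (λ x → freeᵢ x H) (λ k u → if samePVar k u m′ D then false else freeₚ k u H)
                    (updᵢ* β xs (canonical v)) α
    tracks = tᵢ , tₚ
      where
      tᵢ : ∀ x → freeᵢ x H ≡ true → σ v (ind (updᵢ* β xs (canonical v)) x) ≡ ind α x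
      tᵢ x fr = trans (ind-updᵢ*-map (σ v) β βS xs (canonical v) x (σ-below v (paramBound-ind β H x fr)))
                      (cong (λ u → ind (updᵢ* βS xs u) x) (σ-canonical v))
      tₚ : ∀ k u → (if samePVar k u m′ D then false else freeₚ k u H) ≡ true → ∀ w →
           ev (prd α k u) (map (σ v) w) ≡ ev (prd (updᵢ* β xs (canonical v)) k u) w
      tₚ k u fr w = begin
          ev (prd α k u) (map (σ v) w)
        ≡⟨ cong (λ ρ → ev (ρ k u) (map (σ v) w)) (prd-updᵢ* βS xs v) ⟩
          ev (updPrd 𝔐 (prd β) K S graphElem k u) (map (σ v) w)
        ≡⟨ cong (λ P → ev P (map (σ v) w)) (S-unchanged k u free) ⟩
          ev (prd β k u) (map (σ v) w)
        ≡⟨ supported (prd β k u) (σ↔ v) σ-fixes w ⟩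
          ev (prd β k u) w
        ≡⟨ cong (λ ρ → ev (ρ k u) w) (prd-updᵢ* β xs (canonical v)) ⟨
          ev (prd (updᵢ* β xs (canonical v)) k u) w
        ∎
        where
        open ≡-Reasoning
        free : freeₚ k u H ≡ true
        free = ifFalse-≡true⁻ (samePVar k u m′ D) fr
        σ-fixes : Fixes (σ↔ v) (support (prd β k u))
        σ-fixes i i< = σ-below v (<-≤-trans i< (paramBound-prd β H k u free))

    chosen-satisfies : γ ⊨ H
    chosen-satisfies = ⇒ (⊨-transport H (σ↔ v) (Tracks-updₚ m′ D tracks (cong (ev (F v)) ∘ map-from-to (σ↔ v))))
                         (proj₂ (witness (canonical v)))

    ind-updated : ∀ w → map (ind (updᵢ* γ ys w)) (xs ++ ys) ≡ v ++ w
    ind-updated w = begin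
        map (ind (updᵢ* γ ys w)) (xs ++ ys)
      ≡⟨ map-cong (ind-updᵢ*-≗ γ α ys w (λ _ → refl)) (xs ++ ys) ⟩
        map (ind (updᵢ* α ys w)) (xs ++ ys)
      ≡⟨ cong (λ β′ → map (ind β′) (xs ++ ys)) (updᵢ*-++ βS xs v ys w) ⟨
        map (ind (updᵢ* βS (xs ++ ys) (v ++ w))) (xs ++ ys)
      ≡⟨ map-ind-updᵢ* βS (xs ++ ys) (v ++ w) distinct ⟩
        v ++ w
      ∎
      where open ≡-Reasoning

    D-value : ∀ w → ev (prd (updᵢ* γ ys w) m′ D) (map (ind (updᵢ* γ ys w)) ys) ≡ ev (chosen v) w
    D-value w = cong₂ (λ P u → ev P u)
      (trans (cong (λ ρ → ρ m′ D) (prd-updᵢ* γ ys w)) (updPrd-same (prd α) m′ D (chosen v)))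
      (++-injectiveʳ (map (ind γw) xs) v (trans (sym (map-++ (ind γw) xs ys)) (ind-updated w)))
      where γw : Asg
            γw = updᵢ* γ ys w

    S-value : ∀ w → ev (prd (updᵢ* γ ys w) K S) (map (ind (updᵢ* γ ys w)) (xs ++ ys)) ≡ ev (chosen v) w
    S-value w = begin
        ev (prd γw K S) (map (ind γw) (xs ++ ys))  ≡⟨ cong₂ (λ P u → ev P u) prd-S (ind-updated w) ⟩
        graph (v ++ w)                            ≡⟨ graph-++ v w ⟩
        ev (chosen v) w                           ∎
      where
      open ≡-Reasoning
      γw : Asg
      γw = updᵢ* γ ys w
      prd-S : prd γw K S ≡ graphElem
      prd-S = begin
        prd γw K S                                  ≡⟨ cong (λ ρ → ρ K S) (prd-updᵢ* γ ys w) ⟩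
        updPrd 𝔐 (prd α) m′ D (chosen v) K S        ≡⟨ updPrd-other (prd α) m′ D (chosen v) K S m′≢K ⟩
        prd α K S                                   ≡⟨ cong (λ ρ → ρ K S) (prd-updᵢ* βS xs v) ⟩
        updPrd 𝔐 (prd β) K S graphElem K S          ≡⟨ updPrd-same (prd β) K S graphElem ⟩
        graphElem                                   ∎
        where m′≢K : ¬ (m′ ≡ K × D ≡ S)
              m′≢K (m′≡K , _) = m+1+n≢n n′ (sym m′≡K)

    chosen-is-section : γ ⊨ ∀ᵢ* ys (atom m′ D ys ⇔' atom K S (xs ++ ys))
    chosen-is-section = ⇐ (⊨∀ᵢ* ys (atom m′ D ys ⇔' atom K S (xs ++ ys)) γ) λ w →
      (λ d → trans (S-value w) (trans (sym (D-value w)) d)) , (λ s → trans (D-value w) (trans (sym (S-value w)) s))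

  choice-holds : β ⊨ ∃ₚ K S (∀ᵢ* xs (∃ₚ m′ D ((∀ᵢ* ys (atom m′ D ys ⇔' atom K S (xs ++ ys))) ∧' H)))
  choice-holds = graphElem , ⇐ (⊨∀ᵢ* xs _ βS) λ v → chosen v , chosen-is-section v , chosen-satisfies v

choice : (n m : ℕ) → {{_ : NonZero n}} → {{_ : NonZero m}} → ModelOf 𝔐 (choiceₕ n m)
choice (suc n′) (suc m′) ._ (H , xs , ys , D , S , distinct , _ , S∉H , refl) β premise =
  ChoiceInstance.choice-holds n′ m′ H xs ys D S distinct S∉H β (⇒ (⊨∀ᵢ* xs (∃ₚ m′ D H) β) premise)

proposition4p17 : ExcludedMiddle 0ℓ →
    Σ PredStructure λ 𝔄 →
    HenkinAsser 𝔄
    × ((n m : ℕ) → {{_ : NonZero n}} → {{_ : NonZero m}} → ModelOf 𝔄 (choiceₕ n m))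
    × ModelOf 𝔄 (_≡ ¬' WO¹)
proposition4p17 lem = 𝔐 , comprehension lem , choice , ¬wellOrdering
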